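{- Let $k\ge2$ and $r\ge1$. Then $(k,r)\text{ -WL}^2_{I}\preceq(k,r)\text{ -WL}^2_{II}\preceq(k+2,r+1)\text{ -WL}^2_{I}$; that is, for all finite groups $G,H$: if Spoiler has a winning strategy on $G,H$ in the $(k,r)$-WL$^2_I$ game then Spoiler has one in the $(k,r)$-WL$^2_{II}$ game, and if Spoiler has a winning strategy in the $(k,r)$-WL$^2_{II}$ game then Spoiler has one in the $(k+2,r+1)$-WL$^2_I$ game.
   Context: For tuples $\overline{g}\in G^m,\overline{h}\in H^m$: $(\overline{g},\overline{h})$ gives a well-defined map if $g_i=g_j\Leftrightarrow h_i=h_j$ for all $i,j$; a partial isomorphism if moreover $g_ig_j=g_l\Leftrightarrow h_ih_j=h_l$ for all $i,j,l$; a marked isomorphism if well-defined and $g_i\mapsto h_i$ extends to an isomorphism $\langle g_1,\dots,g_m\rangle\to\langle h_1,\dots,h_m\rangle$. The $(k,r)$-WL$^2_J$ game ($J\in\{I,II\}$) on $G,H$: Spoiler and Duplicator, $k$ pebble pairs $(p_i,p_i')$ initially off the board; if $|G|\ne|H|$ Spoiler wins at round $0$. Each round: (1) Spoiler picks up one or two pebble pairs; (2) the winning condition is checked; (3) Duplicator chooses a bijection $f\colon G\to H$; (4) Spoiler places each picked-up $p_i$ on some $v_i\in G$ and $p_i'$ is placed on $f(v_i)$. Spoiler wins if at some check (during the first $r$ rounds, including the configuration after round $r$) the pebbled elements $\overline{v}$ of $G$ and corresponding $\overline{v}'$ of $H$ do not give a partial isomorphism (Version I), respectively a marked isomorphism (Version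 II). -}

module Defs where

open import Data.Nat using (ℕ; zero; suc)
open import Data.Fin using (Fin; _≟_)
open import Data.Maybe using (Maybe; just; nothing)
open import Data.Product using (Σ; _×_; _,_; ∃)
open import Data.Sum using (_⊎_)
open import Relation.Nullary using (¬_; yes; no)
open import Relation.Binary.PropositionalEquality using (_≡_; _≢_)
open import Function.Bundles using (_⤖_; Bijection)
open import Algebra.Structures using (IsGroup)

-- Finite groups: a group structure on the carrier Fin order
-- (every finite group is isomorphic to one of these; the games are
-- invariant under isomorphism).

record FinGroup : Set where
  field
    order   : ℕ
    _∙_     : Fin order → Fin order → Fin order
    ε       : Fin order
    _⁻¹     : Fin order → Fin order
    isGroup : IsGroup _≡_ _∙_ ε _⁻¹

open FinGroup public

Elem : FinGroup → Set
Elem G = Fin (order G)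

data ⟨_⟩[_] (G : FinGroup) (P : Elem G → Set) : Elem G → Set where
  gen : ∀ {x} → P x → ⟨ G ⟩[ P ] x
  one : ⟨ G ⟩[ P ] (ε G)
  mul : ∀ {x y} → ⟨ G ⟩[ P ] x → ⟨ G ⟩[ P ] y → ⟨ G ⟩[ P ] (_∙_ G x y)
  inv : ∀ {x} → ⟨ G ⟩[ P ] x → ⟨ G ⟩[ P ] (_⁻¹ G x)

-- Configurations: pebble pair i is either off the board (nothing) or
-- p_i is on g and p_i' is on h (just (g , h)).

record Config (k : ℕ) (G H : FinGroup) : Set where
  constructor config
  field pos : Fin k → Maybe (Elem G × Elem H)

open Config public

On : ∀ {k G H} → Config k G H → Fin k → Elem G → Elem H → Set
On c i g h = pos c i ≡ just (g , h)

WellDefined : ∀ {k G H} → Config k G H → Set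
WellDefined c = ∀ i j g₁ h₁ g₂ h₂ → On c i g₁ h₁ → On c j g₂ h₂ →
  (g₁ ≡ g₂ → h₁ ≡ h₂) × (h₁ ≡ h₂ → g₁ ≡ g₂)

PartialIso : ∀ {k G H} → Config k G H → Set
PartialIso {k} {G} {H} c = WellDefined c ×
  (∀ i j l g₁ h₁ g₂ h₂ g₃ h₃ → On c i g₁ h₁ → On c j g₂ h₂ → On c l g₃ h₃ →
    (_∙_ G g₁ g₂ ≡ g₃ → _∙_ H h₁ h₂ ≡ h₃) × (_∙_ H h₁ h₂ ≡ h₃ → _∙_ G g₁ g₂ ≡ g₃))

PebG : ∀ {k G H} → Config k G H → Elem G → Set
PebG c g = ∃ λ i → ∃ λ h → On c i g h

PebH : ∀ {k G H} → Config k G H → Elem H → Set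
PebH c h = ∃ λ i → ∃ λ g → On c i g h

-- marked isomorphism: well defined and g_i ↦ h_i extends to an
-- isomorphism ⟨g_1,…,g_m⟩ → ⟨h_1,…,h_m⟩ (given by a map φ : G → H whose
-- restriction to ⟨ḡ⟩ is that isomorphism).
MarkedIso : ∀ {k G H} → Config k G H → Set
MarkedIso {k} {G} {H} c = WellDefined c ×
  Σ (Elem G → Elem H) λ φ →
    (∀ i g h → On c i g h → φ g ≡ h) ×
    (∀ x → ⟨ G ⟩[ PebG c ] x → ⟨ H ⟩[ PebH c ] (φ x)) ×
    (∀ x y → ⟨ G ⟩[ PebG c ] x → ⟨ G ⟩[ PebG c ] y → φ (_∙_ G x y) ≡ _∙_ H (φ x) (φ y)) ×
    (∀ x y → ⟨ G ⟩[ PebG c ] x → ⟨ G ⟩[ PebG c ] y → φ x ≡ φ y → x ≡ y) ×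
    (∀ y → ⟨ H ⟩[ PebH c ] y → ∃ λ x → ⟨ G ⟩[ PebG c ] x × φ x ≡ y)

data Version : Set where
  I II : Version

Good : Version → ∀ {k G H} → Config k G H → Set
Good I  c = PartialIso c
Good II c = MarkedIso c

data Pick (k : ℕ) : Set where
  single : Fin k → Pick k
  double : (i j : Fin k) → i ≢ j → Pick k

Placement : ∀ {k} → FinGroup → Pick k → Set
Placement G (single _)     = Elem G
Placement G (double _ _ _) = Elem G × Elem G

setPos : ∀ {k} {A : Set} → Fin k → A → (Fin k → A) → Fin k → A
setPos i a p x with x ≟ i
... | yes _ = a
... | no  _ = p x

pickUp : ∀ {k G H} → Pick k → Config k G H → Config k G H
pickUp (single i)     c = config (setPos i nothing (pos c))
pickUp (double i j _) c = config (setPos j nothing (setPos i nothing (pos c)))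

place : ∀ {k G H} → (Elem G → Elem H) → (p : Pick k) → Placement G p →
        Config k G H → Config k G H
place f (single i)     v       c = config (setPos i (just (v , f v)) (pos c))
place f (double i j _) (v , w) c =
  config (setPos j (just (w , f w)) (setPos i (just (v , f v)) (pos c)))

SpoilerWinsFrom : Version → (k r : ℕ) (G H : FinGroup) → Config k G H → Set
SpoilerWinsFrom J k zero    G H c = ¬ Good J c
SpoilerWinsFrom J k (suc r) G H c =
  Σ (Pick k) λ p →
    ¬ Good J (pickUp p c)
    ⊎ ((f : Elem G ⤖ Elem H) →
        Σ (Placement G p) λ v →
          SpoilerWinsFrom J k r G H (place (Bijection.to f) p v (pickUp p c)))

emptyConfig : ∀ {k G H} → Config k G H
emptyConfig = config λ _ → nothing

SpoilerWins : Version → (k r : ℕ) (G H : FinGroup) → Set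
SpoilerWins J k r G H = order G ≢ order H ⊎ SpoilerWinsFrom J k r G H emptyConfig

-- A marked isomorphism is a partial isomorphism, so every Version I win
-- is a Version II win.
--
-- Conversely, Spoiler plays his Version II strategy with k of the k + 2
-- pebble pairs, keeping two spare pairs, and wins in the extra round
-- (idling with the spares on ε if the Version II condition already failed
-- earlier). When the pebbled tuples (ḡ, h̄) do not give a marked
-- isomorphism, he picks up the spares and inspects Duplicator's bijection
-- f. If f ε ≠ ε, both spares go on ε. Otherwise f cannot satisfy
-- f (z gᵢ) = f z hᵢ for all z and all pebble pairs (gᵢ, hᵢ): taking z = ε
-- gives f gᵢ = hᵢ, and induction on the generation of x gives
-- f (z x) = f z f x for x ∈ ⟨ḡ⟩, so f would be a marked isomorphism.
-- Spoiler puts the spares on a violating z and on z gᵢ; the product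
-- z · gᵢ is then not respected on the H side.
module Submission where

open import Defs
open import Data.Nat using (ℕ; zero; suc; _≤_; _+_)
open import Data.Nat.Properties using (+-comm)
open import Data.Fin using (Fin; _↑ˡ_; _↑ʳ_; splitAt; _≟_)
open import Data.Fin.Patterns using (0F; 1F)
open import Data.Fin.Properties using (↑ˡ-injective; ↑ʳ-injective; splitAt-↑ˡ; splitAt-↑ʳ; 0≢1+n; all?; ¬∀⟶∃¬)
open import Data.Maybe using (Maybe; just; nothing)
open import Data.Product using (∃; ∃₂; _×_; _,_; proj₁)
open import Data.Sum using (_⊎_; inj₁; inj₂; map₂)
open import Data.Unit using (⊤; tt)
open import Data.Empty using (⊥-elim)
open import Function using (_∘_)
open import Function.Bundles using (Bijection)
open import Relation.Nullary using (¬_; Dec; yes; no)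
open import Relation.Binary.PropositionalEquality
  using (_≡_; _≢_; refl; sym; trans; cong; cong₂; subst; module ≡-Reasoning)
open import Algebra.Bundles using (Group)
import Algebra.Properties.Group as GroupProperties
open import Level using (0ℓ)

private
  variable
    k : ℕ

module FinGroupProperties (G : FinGroup) where

  group : Group 0ℓ 0ℓ
  group = record
    { Carrier = Elem G ; _≈_ = _≡_ ; _∙_ = _∙_ G ; ε = ε G ; _⁻¹ = _⁻¹ G ; isGroup = isGroup G }

  open Group group public using (_∙_; ε; _⁻¹; assoc; identityˡ; identityʳ)
  open GroupProperties group public using (identityˡ-unique; //-rightDividesˡ; //-rightDividesʳ)

⟨⟩-mono : ∀ {G} {P Q : Elem G → Set} → (∀ {g} → P g → Q g) → ∀ {x} → ⟨ G ⟩[ P ] x → ⟨ G ⟩[ Q ] x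
⟨⟩-mono P⊆Q (gen p)   = gen (P⊆Q p)
⟨⟩-mono P⊆Q one       = one
⟨⟩-mono P⊆Q (mul p q) = mul (⟨⟩-mono P⊆Q p) (⟨⟩-mono P⊆Q q)
⟨⟩-mono P⊆Q (inv p)   = inv (⟨⟩-mono P⊆Q p)

setPos-≡ : ∀ {A : Set} (i : Fin k) (a : A) P → setPos i a P i ≡ a
setPos-≡ i a P with i ≟ i
... | yes _ = refl
... | no i≢i = ⊥-elim (i≢i refl)

setPos-≢ : ∀ {A : Set} (i : Fin k) (a : A) P {x} → x ≢ i → setPos i a P x ≡ P x
setPos-≢ i a P {x} x≢i with x ≟ i
... | yes x≡i = ⊥-elim (x≢i x≡i)
... | no _ = refl

setPos-nothing : ∀ {B : Set} (j : Fin k) (P : Fin k → Maybe B) {i u} →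
  setPos j nothing P i ≡ just u → P i ≡ just u
setPos-nothing j P {i} e with i ≟ j
setPos-nothing j P () | yes _
... | no _ = e

spoilerWinsFrom-antimono : ∀ {J J' k r G H} → (∀ {c : Config k G H} → Good J' c → Good J c) →
  ∀ {c} → SpoilerWinsFrom J k r G H c → SpoilerWinsFrom J' k r G H c
spoilerWinsFrom-antimono {r = zero}  J'⊆J ¬good = ¬good ∘ J'⊆J
spoilerWinsFrom-antimono {r = suc r} J'⊆J (p , inj₁ ¬good) = p , inj₁ (¬good ∘ J'⊆J)
spoilerWinsFrom-antimono {r = suc r} J'⊆J (p , inj₂ strategy) = p , inj₂ λ f →
  let v , win = strategy f in v , spoilerWinsFrom-antimono J'⊆J win

module _ {G H : FinGroup} where
  private
    module G = FinGroupProperties G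
    module H = FinGroupProperties H

  markedIso⇒partialIso : {c : Config k G H} → MarkedIso c → PartialIso c
  markedIso⇒partialIso (wd , φ , φ-on , _ , φ-hom , φ-inj , _) =
    wd , λ i j l g₁ h₁ g₂ h₂ g₃ h₃ o₁ o₂ o₃ →
      let p₁ = gen (i , h₁ , o₁)
          p₂ = gen (j , h₂ , o₂)
          φ-∙ : φ (g₁ G.∙ g₂) ≡ h₁ H.∙ h₂
          φ-∙ = trans (φ-hom _ _ p₁ p₂) (cong₂ H._∙_ (φ-on _ _ _ o₁) (φ-on _ _ _ o₂))
      in (λ e → trans (sym φ-∙) (trans (cong φ e) (φ-on _ _ _ o₃)))
       , (λ e → φ-inj _ _ (mul p₁ p₂) (gen (l , h₃ , o₃)) (trans φ-∙ (trans e (sym (φ-on _ _ _ o₃)))))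

  partialIso-ε : (c : Config k G H) (i : Fin k) {h : Elem H} → On c i G.ε h → PartialIso c → h ≡ H.ε
  partialIso-ε _ _ o (_ , mult) =
    H.identityˡ-unique _ _ (proj₁ (mult _ _ _ _ _ _ _ _ _ o o o) (G.identityˡ G.ε))

  module HomOnGenerated {P : Elem G → Set} (φ : Elem G → Elem H)
    (φ-hom : ∀ {x y} → ⟨ G ⟩[ P ] x → ⟨ G ⟩[ P ] y → φ (x G.∙ y) ≡ φ x H.∙ φ y) where

    φ-ε : φ G.ε ≡ H.ε
    φ-ε = H.identityˡ-unique _ _ (trans (sym (φ-hom one one)) (cong φ (G.identityˡ G.ε)))

    φ-⁻¹ : ∀ {x} → ⟨ G ⟩[ P ] x → φ (x G.⁻¹) ≡ φ x H.⁻¹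
    φ-⁻¹ {x} p = GroupProperties.inverseˡ-unique H.group _ _
      (trans (sym (φ-hom (inv p) p)) (trans (cong φ (Group.inverseˡ G.group x)) φ-ε))

    image-⊆ : ∀ {Q : Elem H → Set} → (∀ {g} → P g → Q (φ g)) →
      ∀ {x} → ⟨ G ⟩[ P ] x → ⟨ H ⟩[ Q ] (φ x)
    image-⊆ {Q} P→Q (gen p)   = gen (P→Q p)
    image-⊆ {Q} P→Q one       = subst ⟨ H ⟩[ Q ] (sym φ-ε) one
    image-⊆ {Q} P→Q (mul p q) = subst ⟨ H ⟩[ Q ] (sym (φ-hom p q)) (mul (image-⊆ P→Q p) (image-⊆ P→Q q))
    image-⊆ {Q} P→Q (inv p)   = subst ⟨ H ⟩[ Q ] (sym (φ-⁻¹ p)) (inv (image-⊆ P→Q p))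

    image-⊇ : ∀ {Q : Elem H → Set} → (∀ {h} → Q h → ∃ λ g → P g × φ g ≡ h) →
      ∀ {y} → ⟨ H ⟩[ Q ] y → ∃ λ x → ⟨ G ⟩[ P ] x × φ x ≡ y
    image-⊇ Q→P (gen q) with Q→P q
    ... | g , p , φg≡h = g , gen p , φg≡h
    image-⊇ Q→P one = G.ε , one , φ-ε
    image-⊇ Q→P (mul q q') with image-⊇ Q→P q | image-⊇ Q→P q'
    ... | x , p , φx≡y | x' , p' , φx'≡y' =
      x G.∙ x' , mul p p' , trans (φ-hom p p') (cong₂ H._∙_ φx≡y φx'≡y')
    image-⊇ Q→P (inv q) with image-⊇ Q→P q
    ... | x , p , φx≡y = x G.⁻¹ , inv p , trans (φ-⁻¹ p) (cong H._⁻¹ φx≡y)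

  markedIso-intro : {c : Config k G H} (φ : Elem G → Elem H) →
    (∀ {i g h} → On c i g h → φ g ≡ h) →
    (∀ {x y} → ⟨ G ⟩[ PebG c ] x → ⟨ G ⟩[ PebG c ] y → φ (x G.∙ y) ≡ φ x H.∙ φ y) →
    (∀ {x y} → ⟨ G ⟩[ PebG c ] x → ⟨ G ⟩[ PebG c ] y → φ x ≡ φ y → x ≡ y) →
    MarkedIso c
  markedIso-intro {c = c} φ φ-on φ-hom φ-inj =
      (λ _ _ _ _ _ _ o₁ o₂ →
          (λ e → trans (sym (φ-on o₁)) (trans (cong φ e) (φ-on o₂)))
        , (λ e → φ-inj (gen (_ , _ , o₁)) (gen (_ , _ , o₂)) (trans (φ-on o₁) (trans e (sym (φ-on o₂))))))
    , φ , (λ _ _ _ → φ-on)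
    , (λ _ → image-⊆ λ { (i , h , o) → i , _ , subst (On c i _) (sym (φ-on o)) o })
    , (λ _ _ → φ-hom) , (λ _ _ → φ-inj)
    , (λ _ → image-⊇ λ { (i , g , o) → g , (i , _ , o) , φ-on o })
    where open HomOnGenerated φ φ-hom

  _⊑_ : Config k G H → Config k G H → Set
  d ⊑ c = ∀ {i g h} → On d i g h → On c i g h

  pickUp-⊑ : (p : Pick k) (c : Config k G H) → pickUp p c ⊑ c
  pickUp-⊑ (single j)     c = setPos-nothing j (pos c)
  pickUp-⊑ (double j j' _) c {i} = setPos-nothing j (pos c) {i} ∘ setPos-nothing j' _ {i}

  markedIso-⊑ : {c d : Config k G H} → d ⊑ c → MarkedIso c → MarkedIso d
  markedIso-⊑ {c = c} {d} d⊑c (_ , φ , φ-on , _ , φ-hom , φ-inj , _) =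
    markedIso-intro φ (φ-on _ _ _ ∘ d⊑c)
      (λ p q → φ-hom _ _ (widen p) (widen q)) (λ p q → φ-inj _ _ (widen p) (widen q))
    where
      widen : ∀ {x} → ⟨ G ⟩[ PebG d ] x → ⟨ G ⟩[ PebG c ] x
      widen = ⟨⟩-mono λ { (i , h , o) → i , h , d⊑c o }

  Respects : (Elem G → Elem H) → Elem G → Maybe (Elem G × Elem H) → Set
  Respects F z nothing        = ⊤
  Respects F z (just (g , h)) = F (z G.∙ g) ≡ F z H.∙ h

  respects? : ∀ F z m → Dec (Respects F z m)
  respects? F z nothing        = yes tt
  respects? F z (just (g , h)) = F (z G.∙ g) ≟ F z H.∙ h

  LeftCompatible : (Elem G → Elem H) → Config k G H → Set
  LeftCompatible F c = ∀ z i → Respects F z (pos c i)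

  leftCompatible-or-violated : ∀ F (c : Config k G H) →
    LeftCompatible F c ⊎ ∃₂ λ z i → ¬ Respects F z (pos c i)
  leftCompatible-or-violated F c with all? (λ z → all? (λ i → respects? F z (pos c i)))
  ... | yes compatible = inj₁ compatible
  ... | no ¬compatible with ¬∀⟶∃¬ _ _ (λ z → all? (λ i → respects? F z (pos c i))) ¬compatible
  ...   | z , ¬∀i with ¬∀⟶∃¬ _ _ (λ i → respects? F z (pos c i)) ¬∀i
  ...     | i , ¬respects = inj₂ (z , i , ¬respects)

  module _ {c : Config k G H} {F : Elem G → Elem H}
    (F-ε : F G.ε ≡ H.ε) (compatible : LeftCompatible F c) where

    respects-on : ∀ z {i g h} → On c i g h → F (z G.∙ g) ≡ F z H.∙ h
    respects-on z {i} o = subst (Respects F z) o (compatible z i)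

    leftCompatible-on : ∀ {i g h} → On c i g h → F g ≡ h
    leftCompatible-on {g = g} {h} o = begin
      F g               ≡⟨ cong F (G.identityˡ g) ⟨
      F (G.ε G.∙ g)     ≡⟨ respects-on G.ε o ⟩
      F G.ε H.∙ h       ≡⟨ cong (H._∙ h) F-ε ⟩
      H.ε H.∙ h         ≡⟨ H.identityˡ h ⟩
      h                 ∎
      where open ≡-Reasoning

    leftCompatible-translation : ∀ {x} → ⟨ G ⟩[ PebG c ] x → ∀ z → F (z G.∙ x) ≡ F z H.∙ F x
    leftCompatible-translation (gen (i , h , o)) z =
      trans (respects-on z o) (cong (F z H.∙_) (sym (leftCompatible-on o)))
    leftCompatible-translation one z = begin
      F (z G.∙ G.ε)     ≡⟨ cong F (G.identityʳ z) ⟩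
      F z               ≡⟨ H.identityʳ (F z) ⟨
      F z H.∙ H.ε       ≡⟨ cong (F z H.∙_) F-ε ⟨
      F z H.∙ F G.ε     ∎
      where open ≡-Reasoning
    leftCompatible-translation (mul {x} {y} p q) z = begin
      F (z G.∙ (x G.∙ y))       ≡⟨ cong F (G.assoc z x y) ⟨
      F ((z G.∙ x) G.∙ y)       ≡⟨ leftCompatible-translation q (z G.∙ x) ⟩
      F (z G.∙ x) H.∙ F y       ≡⟨ cong (H._∙ F y) (leftCompatible-translation p z) ⟩
      (F z H.∙ F x) H.∙ F y     ≡⟨ H.assoc (F z) (F x) (F y) ⟩
      F z H.∙ (F x H.∙ F y)     ≡⟨ cong (F z H.∙_) (leftCompatible-translation q x) ⟨
      F z H.∙ F (x G.∙ y)       ∎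
      where open ≡-Reasoning
    leftCompatible-translation (inv {x} p) z =
      trans (F-divide z) (cong (F z H.∙_) (sym F-⁻¹))
      where
        open ≡-Reasoning
        F-divide : ∀ z → F (z G.∙ x G.⁻¹) ≡ F z H.∙ F x H.⁻¹
        F-divide z = begin
          F (z G.∙ x G.⁻¹)                           ≡⟨ H.//-rightDividesʳ (F x) _ ⟨
          (F (z G.∙ x G.⁻¹) H.∙ F x) H.∙ F x H.⁻¹    ≡⟨ cong (H._∙ F x H.⁻¹) (leftCompatible-translation p _) ⟨
          F ((z G.∙ x G.⁻¹) G.∙ x) H.∙ F x H.⁻¹      ≡⟨ cong (λ u → F u H.∙ F x H.⁻¹) (G.//-rightDividesˡ x z) ⟩
          F z H.∙ F x H.⁻¹                           ∎
        F-⁻¹ : F (x G.⁻¹) ≡ F x H.⁻¹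
        F-⁻¹ = begin
          F (x G.⁻¹)             ≡⟨ cong F (G.identityˡ _) ⟨
          F (G.ε G.∙ x G.⁻¹)     ≡⟨ F-divide G.ε ⟩
          F G.ε H.∙ F x H.⁻¹     ≡⟨ cong (H._∙ F x H.⁻¹) F-ε ⟩
          H.ε H.∙ F x H.⁻¹       ≡⟨ H.identityˡ _ ⟩
          F x H.⁻¹               ∎

    leftCompatible⇒markedIso : (∀ {x y} → F x ≡ F y → x ≡ y) → MarkedIso c
    leftCompatible⇒markedIso F-inj = markedIso-intro F leftCompatible-on
      (λ p q → leftCompatible-translation q _) (λ _ _ → F-inj)

module TwoSparePebbles (k : ℕ) {G H : FinGroup} where
  private
    module G = FinGroupProperties G
    module H = FinGroupProperties H

  ι : Fin k → Fin (k + 2)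
  ι i = i ↑ˡ 2

  a b : Fin (k + 2)
  a = k ↑ʳ 0F
  b = k ↑ʳ 1F

  a≢b : a ≢ b
  a≢b = 0≢1+n ∘ ↑ʳ-injective k 0F 1F

  ι≢spare : ∀ i j → ι i ≢ k ↑ʳ j
  ι≢spare i j e with trans (sym (splitAt-↑ˡ k i 2)) (trans (cong (splitAt k) e) (splitAt-↑ʳ k 2 j))
  ... | ()

  Extends : Config k G H → Config (k + 2) G H → Set
  Extends c d = ∀ i → pos d (ι i) ≡ pos c i

  setPos-ι : ∀ {A : Set} i (v : A) (Q : Fin (k + 2) → A) (P : Fin k → A) →
    (∀ x → Q (ι x) ≡ P x) → ∀ x → setPos (ι i) v Q (ι x) ≡ setPos i v P x
  setPos-ι i v Q P Q∘ι≡P x with x ≟ i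
  ... | yes refl = setPos-≡ (ι x) v Q
  ... | no x≢i = trans (setPos-≢ (ι i) v Q (x≢i ∘ ↑ˡ-injective 2 x i)) (Q∘ι≡P x)

  liftPick : Pick k → Pick (k + 2)
  liftPick (single i)       = single (ι i)
  liftPick (double i j i≢j) = double (ι i) (ι j) (i≢j ∘ ↑ˡ-injective 2 i j)

  liftPlacement : (p : Pick k) → Placement G p → Placement G (liftPick p)
  liftPlacement (single _)     v = v
  liftPlacement (double _ _ _) v = v

  move-extends : ∀ (p : Pick k) F v {c d} → Extends c d →
    Extends (place F p v (pickUp p c)) (place F (liftPick p) (liftPlacement p v) (pickUp (liftPick p) d))
  move-extends (single i) F v d≥c =
    setPos-ι i _ _ _ (setPos-ι i _ _ _ d≥c)
  move-extends (double i j _) F (v , w) d≥c =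
    setPos-ι j _ _ _ (setPos-ι i _ _ _ (setPos-ι j _ _ _ (setPos-ι i _ _ _ d≥c)))

  pickSpares : Pick (k + 2)
  pickSpares = double a b a≢b

  placeSpares : (Elem G → Elem H) → Elem G → Elem G → Config (k + 2) G H → Config (k + 2) G H
  placeSpares F v w d = place F pickSpares (v , w) (pickUp pickSpares d)

  module _ (F : Elem G → Elem H) (v w : Elem G) (d : Config (k + 2) G H) where
    placeSpares-a : On (placeSpares F v w d) a v (F v)
    placeSpares-a = trans (setPos-≢ b _ (setPos a _ (pos (pickUp pickSpares d))) {a} a≢b) (setPos-≡ a _ _)

    placeSpares-b : On (placeSpares F v w d) b w (F w)
    placeSpares-b = setPos-≡ b _ _

    placeSpares-extends : ∀ {c} → Extends c d → Extends c (placeSpares F v w d)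
    placeSpares-extends d≥c x =
      trans (setPos-≢ b _ _ (ι≢spare x 1F))
      (trans (setPos-≢ a _ _ (ι≢spare x 0F))
      (trans (setPos-≢ b _ _ (ι≢spare x 1F))
      (trans (setPos-≢ a _ _ (ι≢spare x 0F)) (d≥c x))))

  refute-markedIso : ∀ {c d} → Extends c d → ¬ MarkedIso c →
    (F : Elem G → Elem H) → (∀ {x y} → F x ≡ F y → x ≡ y) →
    ∃₂ λ v w → ¬ PartialIso (placeSpares F v w d)
  refute-markedIso {c} {d} d≥c ¬mi F F-inj with F G.ε ≟ H.ε
  ... | no Fε≢ε = G.ε , G.ε , λ pi →
    Fε≢ε (partialIso-ε (placeSpares F G.ε G.ε d) a (placeSpares-a F G.ε G.ε d) pi)
  ... | yes Fε≡ε with leftCompatible-or-violated F c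
  ...   | inj₁ compatible = ⊥-elim (¬mi (leftCompatible⇒markedIso Fε≡ε compatible F-inj))
  ...   | inj₂ (z , i , ¬respects) with pos c i in posᵢ
  ...     | nothing = ⊥-elim (¬respects tt)
  ...     | just (g , h) = z , z G.∙ g , λ (_ , mult) →
    ¬respects (sym (proj₁ (mult a (ι i) b _ _ _ _ _ _
      (placeSpares-a F z (z G.∙ g) d)
      (trans (placeSpares-extends F z (z G.∙ g) d d≥c i) posᵢ)
      (placeSpares-b F z (z G.∙ g) d)) refl))

  spoilerWinsFrom-¬markedIso : ∀ {c d} → Extends c d → ¬ MarkedIso c →
    ∀ r → SpoilerWinsFrom I (k + 2) (suc r) G H d
  spoilerWinsFrom-¬markedIso d≥c ¬mi zero = pickSpares , inj₂ λ f →
    let v , w , ¬pi = refute-markedIso d≥c ¬mi (Bijection.to f) (Bijection.injective f)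
    in (v , w) , ¬pi
  spoilerWinsFrom-¬markedIso d≥c ¬mi (suc r) = pickSpares , inj₂ λ f →
    (G.ε , G.ε) , spoilerWinsFrom-¬markedIso (placeSpares-extends (Bijection.to f) G.ε G.ε _ d≥c) ¬mi r

  simulate : ∀ r {c d} → Extends c d →
    SpoilerWinsFrom II k r G H c → SpoilerWinsFrom I (k + 2) (suc r) G H d
  simulate zero    d≥c ¬mi = spoilerWinsFrom-¬markedIso d≥c ¬mi zero
  simulate (suc r) d≥c (p , inj₁ ¬mi) =
    spoilerWinsFrom-¬markedIso d≥c (¬mi ∘ markedIso-⊑ (pickUp-⊑ p _)) (suc r)
  simulate (suc r) d≥c (p , inj₂ strategy) = liftPick p , inj₂ λ f →
    let v , win = strategy f
    in liftPlacement p v , simulate r (move-extends p (Bijection.to f) v d≥c) win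

spoilerWins-II⇒I : ∀ {k r G H} → SpoilerWins II k r G H → SpoilerWins I (k + 2) (suc r) G H
spoilerWins-II⇒I (inj₁ |G|≢|H|) = inj₁ |G|≢|H|
spoilerWins-II⇒I {k} {r} (inj₂ win) = inj₂ (TwoSparePebbles.simulate k r (λ _ → refl) win)

theorem13 : (k r : ℕ) → 2 ≤ k → 1 ≤ r → (G H : FinGroup) →
    (SpoilerWins I k r G H → SpoilerWins II k r G H) ×
    (SpoilerWins II k r G H → SpoilerWins I (k + 2) (r + 1) G H)
-- The inclusions hold for all k and r.
theorem13 k r _ _ G H =
    map₂ (spoilerWinsFrom-antimono markedIso⇒partialIso)
  , subst (λ n → SpoilerWins I (k + 2) n G H) (+-comm 1 r) ∘ spoilerWins-II⇒I
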